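{- Let $f$ be a positive integer and $D$ a square-free positive integer, and let $\theta=f\cdot i\sqrt{D}$ if $D\not\equiv 3\pmod 4$, and $\theta=f\cdot\frac{1+i\sqrt{D}}{2}$ if $D\equiv 3\pmod 4$. Let $M$ be a positive integer. Then there exists $\ell\in\{1,\dots,M\}$ such that for every integer $a$ with $a\equiv 2\ell-1\pmod{2M}$ we have $\gcd(N(a+4\theta),2M)=1$.
   Context: $N(\gamma)=\gamma\bar{\gamma}$ denotes the norm from $\mathbb{Q}(i\sqrt{D})$ to $\mathbb{Q}$, with $\bar{\gamma}$ the complex conjugate of $\gamma$. -}

module Defs where

open import Data.Nat as ℕ using (ℕ; suc)
open import Data.Nat.Divisibility as ℕD using ()
open import Data.Integer as ℤ using (ℤ; +_; _+_; _*_)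
open import Data.Integer.DivMod using (_/_)
open import Relation.Binary.PropositionalEquality using (_≡_)
open import Relation.Nullary using (Dec; yes; no)

SquareFree : ℕ → Set
SquareFree D = ∀ (p : ℕ) → (p ℕ.* p) ℕD.∣ D → p ≡ 1

-- Elements of Q(i√D) whose coordinates lie in (1/2)ℤ:
-- half x y  represents  (x + y·i√D) / 2 .
-- This contains the ring of integers of Q(i√D) (D square-free), so all
-- elements in the statement are represented.
record Elt : Set where
  constructor half
  field
    re2 : ℤ
    im2 : ℤ

open Elt public

_⊕_ : Elt → Elt → Elt
half x y ⊕ half x' y' = half (x + x') (y + y')

ι : ℤ → Elt
ι a = half (+ 2 * a) (+ 0)

_·_ : ℤ → Elt → Elt
n · half x y = half (n * x) (n * y)

-- 4·N(γ) = x² + D y² for γ = (x + y i√D)/2  (γ·conj γ = (x² + D y²)/4)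
4N : ℕ → Elt → ℤ
4N D (half x y) = x * x + (+ D) * (y * y)

-- N(γ) = γ γ̄ ; exact (integer) for algebraic integers γ, in particular
-- for all γ of the form a + 4θ considered in the statement.
N : ℕ → Elt → ℤ
N D γ = 4N D γ / (+ 4)

θ : ℕ → ℕ → Elt
θ f D with D ℕ.% 4 ℕ.≟ 3
... | yes _ = (+ f) · half (+ 1) (+ 1)
... | no  _ = (+ f) · half (+ 0) (+ 2)

-- N(a + 4θ) = (a + 2s)² + 2c for some s ∈ ℤ, c ∈ ℕ depending only on f and D.
-- For every c and M > 0 some w makes (1 + c w)² + c coprime to M: if gcd(c, M) = 1,
-- pick w with M ∣ 1 + c w, so the value is ≡ c (mod M); otherwise the value is
-- ≡ 1 (mod c), hence coprime to gcd(c, M), and it suffices to treat M / gcd(c, M).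
-- Apply this to 2c and 2M, put b = 1 + 2c w (odd) and choose l with 2l − 1 ≡ b − 2s
-- (mod 2M). Then a ≡ 2l − 1 gives a + 2s ≡ b, so N(a + 4θ) ≡ b² + 2c (mod 2M).

module Submission where

open import Defs
open import Data.Nat as ℕ using (ℕ; suc; _≤_; s≤s; z≤n; NonZero)
import Data.Nat.Properties as ℕ
open import Data.Nat.Divisibility as ℕ using (divides; quotient; quotient≢0; quotient-<; m∣n⇒n≡m*quotient; ∣1⇒≡1; ∣m+n∣m⇒∣n; ∣m⇒∣m*n; ∣-trans)
open import Data.Nat.Coprimality using (Coprime; coprime?; coprime-Bézout; coprime-divisor; gcd≡1⇒coprime; coprime⇒gcd≡1) renaming (sym to coprime-sym)
open import Data.Nat.GCD as ℕ using (module Bézout; gcd[m,n]∣m; gcd[m,n]∣n; gcd[m,n]≢0)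
open import Data.Nat.Induction using (<-rec)
open import Data.Nat.Tactic.RingSolver as ℕ-Solver using ()
import Data.Integer as ℤ using (NonZero)
open import Data.Integer using (ℤ; +_; -[1+_]; _+_; _*_; _-_; ∣_∣)
open import Data.Integer.GCD using (gcd)
open import Data.Integer.Divisibility using (_∣_)
import Data.Integer.Divisibility.Signed as Signed
open import Data.Integer.DivMod using (_/_; _%ℕ_; _/ℕ_; n%ℕd<d; a≡a%ℕn+[a/ℕn]*n; div-pos-is-/ℕ)
open import Data.Nat.DivMod using (m*n/n≡m)
open import Data.Integer.Properties using (pos-+; pos-*)
open import Data.Integer.Tactic.RingSolver as ℤ-Solver using ()
open import Data.Product using (∃; _×_; _,_)
open import Data.Sum using (inj₂)
open import Relation.Binary.PropositionalEquality using (_≡_; refl; sym; trans; cong; cong₂; subst; module ≡-Reasoning)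
open import Relation.Nullary using (yes; no)

coprime-*ʳ : ∀ {x m n} → Coprime x m → Coprime x n → Coprime x (m ℕ.* n)
coprime-*ʳ {x} {m} {n} x⊥m x⊥n {d} (d∣x , d∣mn) = x⊥n (d∣x , coprime-divisor d⊥m d∣mn)
  where
  d⊥m : Coprime d m
  d⊥m (e∣d , e∣m) = x⊥m (∣-trans e∣d d∣x , e∣m)

coprime⇒∃[w]∣1+cw : ∀ c M → .{{NonZero M}} → Coprime M c → ∃ λ w → M ℕ.∣ 1 ℕ.+ c ℕ.* w
coprime⇒∃[w]∣1+cw c (suc m) cop with coprime-Bézout cop
... | Bézout.+- x y eq = y , divides x (trans (cong (1 ℕ.+_) (ℕ.*-comm c y)) eq)
... | Bézout.-+ x y eq = y ℕ.* m , divides (1 ℕ.+ x ℕ.* m) (begin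
  1 ℕ.+ c ℕ.* (y ℕ.* m)             ≡⟨ reassoc c y m ⟩
  1 ℕ.+ (y ℕ.* c) ℕ.* m             ≡⟨ cong (λ z → 1 ℕ.+ z ℕ.* m) eq ⟨
  1 ℕ.+ (1 ℕ.+ x ℕ.* suc m) ℕ.* m   ≡⟨ factor x m ⟩
  (1 ℕ.+ x ℕ.* m) ℕ.* suc m         ∎)
  where
  open ≡-Reasoning
  reassoc : ∀ c y m → 1 ℕ.+ c ℕ.* (y ℕ.* m) ≡ 1 ℕ.+ (y ℕ.* c) ℕ.* m
  reassoc = ℕ-Solver.solve-∀
  factor : ∀ x m → 1 ℕ.+ (1 ℕ.+ x ℕ.* suc m) ℕ.* m ≡ (1 ℕ.+ x ℕ.* m) ℕ.* suc m
  factor = ℕ-Solver.solve-∀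

shiftedSquare : ℕ → ℕ → ℕ
shiftedSquare c w = (1 ℕ.+ c ℕ.* w) ℕ.* (1 ℕ.+ c ℕ.* w) ℕ.+ c

shiftedSquare-coprime : ∀ c w → Coprime (shiftedSquare c w) c
shiftedSquare-coprime c w {d} (d∣F , d∣c) =
  ∣1⇒≡1 (∣m+n∣m⇒∣n (subst (d ℕ.∣_) (expand c w) d∣F) (∣m⇒∣m*n _ d∣c))
  where
  expand : ∀ c w → (1 ℕ.+ c ℕ.* w) ℕ.* (1 ℕ.+ c ℕ.* w) ℕ.+ c ≡ c ℕ.* (w ℕ.* (2 ℕ.+ c ℕ.* w) ℕ.+ 1) ℕ.+ 1
  expand = ℕ-Solver.solve-∀

∃-coprime-shiftedSquare : ∀ c M → .{{NonZero M}} → ∃ λ w → Coprime (shiftedSquare c w) M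
∃-coprime-shiftedSquare c = <-rec P go
  where
  P : ℕ → Set
  P M = .{{NonZero M}} → ∃ λ w → Coprime (shiftedSquare c w) M
  go : ∀ M → (∀ {n} → n ℕ.< M → P n) → P M
  go M _ with coprime? c M
  ... | yes c⊥M with coprime⇒∃[w]∣1+cw c M (coprime-sym c⊥M)
  ...   | w , M∣1+cw = w , λ (d∣F , d∣M) → c⊥M (∣m+n∣m⇒∣n d∣F (∣m⇒∣m*n _ (∣-trans d∣M M∣1+cw)) , d∣M)
  go M rec | no ¬c⊥M =
    let w , F⊥q = rec (quotient-< g∣M) in
    w , subst (Coprime (shiftedSquare c w)) (sym (m∣n⇒n≡m*quotient g∣M))
              (coprime-*ʳ (λ (d∣F , d∣g) → shiftedSquare-coprime c w (d∣F , ∣-trans d∣g (gcd[m,n]∣m c M))) F⊥q)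
    where
    g∣M : ℕ.gcd c M ℕ.∣ M
    g∣M = gcd[m,n]∣n c M
    instance
      g-nonTrivial : ℕ.NonTrivial (ℕ.gcd c M)
      g-nonTrivial = ℕ.n>1⇒nonTrivial (ℕ.≤∧≢⇒< (ℕ.n≢0⇒n>0 (gcd[m,n]≢0 c M (inj₂ (ℕ.≢-nonZero⁻¹ M))))
                                                 (λ 1≡g → ¬c⊥M (gcd≡1⇒coprime (sym 1≡g))))
      q-nonZero : NonZero (quotient g∣M)
      q-nonZero = quotient≢0 g∣M

i*i≡∣i∣*∣i∣ : ∀ i → i * i ≡ + (∣ i ∣ ℕ.* ∣ i ∣)
i*i≡∣i∣*∣i∣ (+ n)    = sym (pos-* n n)
i*i≡∣i∣*∣i∣ -[1+ n ] = refl

+n*+d/+d≡+n : ∀ n d → .{{_ : ℤ.NonZero (+ d)}} → (+ n * + d) / + d ≡ + n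
+n*+d/+d≡+n n d = begin
  (+ n * + d) / + d    ≡⟨ cong (_/ + d) (pos-* n d) ⟨
  + (n ℕ.* d) / + d    ≡⟨ div-pos-is-/ℕ (+ (n ℕ.* d)) d ⟩
  + (n ℕ.* d ℕ./ d)    ≡⟨ cong +_ (m*n/n≡m n d) ⟩
  + n                  ∎
  where open ≡-Reasoning

coprime-≡[mod] : ∀ {m} x y → + m Signed.∣ x - y → Coprime ∣ y ∣ m → Coprime ∣ x ∣ m
coprime-≡[mod] {m} x y m∣x-y y⊥m {d} (d∣x , d∣m) = y⊥m (Signed.∣⇒∣ᵤ d∣y , d∣m)
  where
  d∣y : + d Signed.∣ y
  d∣y = subst (+ d Signed.∣_) (x-[x-y]≡y x y)
          (Signed.∣m∣n⇒∣m-n (Signed.∣ᵤ⇒∣ {i = x} d∣x) (Signed.∣-trans (Signed.∣ᵤ⇒∣ d∣m) m∣x-y))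
    where
    x-[x-y]≡y : ∀ x y → x - (x - y) ≡ y
    x-[x-y]≡y = ℤ-Solver.solve-∀

∣-resp-square : ∀ {m} u b C → m Signed.∣ u - b → m Signed.∣ (u * u + C) - (b * b + C)
∣-resp-square {m} u b C m∣u-b =
  subst (m Signed.∣_) (sym (difference u b C)) (Signed.∣m⇒∣m*n (u + b) m∣u-b)
  where
  difference : ∀ u b C → (u * u + C) - (b * b + C) ≡ (u - b) * (u + b)
  difference = ℤ-Solver.solve-∀

∃-odd-representative : ∀ M → .{{NonZero M}} → (k : ℤ) →
  ∃ λ l → 1 ≤ l × l ≤ M × + (2 ℕ.* M) Signed.∣ (+ 1 + + 2 * k) - (+ (2 ℕ.* l) - + 1)
∃-odd-representative M k = suc r , s≤s z≤n , n%ℕd<d k M , Signed.divides q (begin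
  (+ 1 + + 2 * k) - (+ (2 ℕ.* suc r) - + 1)
    ≡⟨ cong₂ (λ k L → (+ 1 + + 2 * k) - (L - + 1)) (a≡a%ℕn+[a/ℕn]*n k M)
             (trans (pos-* 2 (suc r)) (cong (+ 2 *_) (pos-+ 1 r))) ⟩
  (+ 1 + + 2 * (+ r + q * + M)) - (+ 2 * (+ 1 + + r) - + 1)
    ≡⟨ cancel (+ r) q (+ M) ⟩
  q * (+ 2 * + M)
    ≡⟨ cong (q *_) (pos-* 2 M) ⟨
  q * + (2 ℕ.* M)  ∎)
  where
  open ≡-Reasoning
  r = k %ℕ M
  q = k /ℕ M
  cancel : ∀ r q M → (+ 1 + + 2 * (r + q * M)) - (+ 2 * (+ 1 + r) - + 1) ≡ q * (+ 2 * M)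
  cancel = ℤ-Solver.solve-∀

∃-odd-class-coprime : ∀ M → .{{NonZero M}} → (s : ℤ) (c : ℕ) →
  ∃ λ l → 1 ≤ l × l ≤ M × (∀ a → + (2 ℕ.* M) ∣ a - (+ (2 ℕ.* l) - + 1) →
    gcd ((a + + 2 * s) * (a + + 2 * s) + + (2 ℕ.* c)) (+ (2 ℕ.* M)) ≡ + 1)
∃-odd-class-coprime M s c with ∃-coprime-shiftedSquare (2 ℕ.* c) (2 ℕ.* M) {{ℕ.m*n≢0 2 M}}
... | w , F⊥2M with ∃-odd-representative M (+ (c ℕ.* w) - s)
... | l , 1≤l , l≤M , 2M∣b-2s-[2l-1] = l , 1≤l , l≤M , λ a 2M∣a-[2l-1] →
  let u = a + + 2 * s in
  cong +_ (coprime⇒gcd≡1 (coprime-≡[mod] (u * u + + (2 ℕ.* c)) (+ b * + b + + (2 ℕ.* c))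
    (∣-resp-square u (+ b) (+ (2 ℕ.* c)) (2M∣a+2s-b a 2M∣a-[2l-1])) b²+2c⊥2M))
  where
  b : ℕ
  b = 1 ℕ.+ 2 ℕ.* c ℕ.* w
  b²+2c⊥2M : Coprime ∣ + b * + b + + (2 ℕ.* c) ∣ (2 ℕ.* M)
  b²+2c⊥2M = subst (λ z → Coprime ∣ z ∣ (2 ℕ.* M)) (trans (pos-+ (b ℕ.* b) (2 ℕ.* c)) (cong (_+ + (2 ℕ.* c)) (pos-* b b))) F⊥2M
  2M∣a+2s-b : ∀ a → + (2 ℕ.* M) ∣ a - (+ (2 ℕ.* l) - + 1) → + (2 ℕ.* M) Signed.∣ (a + + 2 * s) - + b
  2M∣a+2s-b a h = subst (+ (2 ℕ.* M) Signed.∣_) (begin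
    (a - (L - + 1)) - ((+ 1 + + 2 * (+ (c ℕ.* w) - s)) - (L - + 1)) ≡⟨ rearrange a L s (+ (c ℕ.* w)) ⟩
    (a + + 2 * s) - (+ 1 + + 2 * + (c ℕ.* w))                       ≡⟨ cong (λ z → (a + + 2 * s) - z) b-cast ⟨
    (a + + 2 * s) - + b                                             ∎)
    (Signed.∣m∣n⇒∣m-n (Signed.∣ᵤ⇒∣ {i = a - (L - + 1)} h) 2M∣b-2s-[2l-1])
    where
    open ≡-Reasoning
    L = + (2 ℕ.* l)
    rearrange : ∀ a L s cw → (a - (L - + 1)) - ((+ 1 + + 2 * (cw - s)) - (L - + 1)) ≡ (a + + 2 * s) - (+ 1 + + 2 * cw)
    rearrange = ℤ-Solver.solve-∀
    b-cast : + b ≡ + 1 + + 2 * + (c ℕ.* w)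
    b-cast = trans (pos-+ 1 (2 ℕ.* c ℕ.* w)) (cong (_+_ (+ 1)) (trans (cong +_ (ℕ.*-assoc 2 c w)) (pos-* 2 (c ℕ.* w))))

N-half-even : ∀ D x y → N D (half (+ 2 * x) (+ 2 * y)) ≡ x * x + + D * (y * y)
N-half-even D x y = begin
  4N D (half (+ 2 * x) (+ 2 * y)) / + 4                          ≡⟨ cong (_/ + 4) (expand x y (+ D)) ⟩
  (x * x + + D * (y * y)) * + 4 / + 4                            ≡⟨ cong (λ z → z * + 4 / + 4) nonneg ⟩
  + (∣ x ∣ ℕ.* ∣ x ∣ ℕ.+ D ℕ.* (∣ y ∣ ℕ.* ∣ y ∣)) * + 4 / + 4    ≡⟨ +n*+d/+d≡+n _ 4 ⟩
  + (∣ x ∣ ℕ.* ∣ x ∣ ℕ.+ D ℕ.* (∣ y ∣ ℕ.* ∣ y ∣))                ≡⟨ nonneg ⟨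
  x * x + + D * (y * y)                                          ∎
  where
  open ≡-Reasoning
  expand : ∀ x y D → (+ 2 * x) * (+ 2 * x) + D * ((+ 2 * y) * (+ 2 * y)) ≡ (x * x + D * (y * y)) * + 4
  expand = ℤ-Solver.solve-∀
  nonneg : x * x + + D * (y * y) ≡ + (∣ x ∣ ℕ.* ∣ x ∣ ℕ.+ D ℕ.* (∣ y ∣ ℕ.* ∣ y ∣))
  nonneg = begin
    x * x + + D * (y * y)                                   ≡⟨ cong₂ (λ u v → u + + D * v) (i*i≡∣i∣*∣i∣ x) (i*i≡∣i∣*∣i∣ y) ⟩
    + (∣ x ∣ ℕ.* ∣ x ∣) + + D * + (∣ y ∣ ℕ.* ∣ y ∣)         ≡⟨ cong (_+_ (+ (∣ x ∣ ℕ.* ∣ x ∣))) (pos-* D _) ⟨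
    + (∣ x ∣ ℕ.* ∣ x ∣) + + (D ℕ.* (∣ y ∣ ℕ.* ∣ y ∣))        ≡⟨ pos-+ (∣ x ∣ ℕ.* ∣ x ∣) _ ⟨
    + (∣ x ∣ ℕ.* ∣ x ∣ ℕ.+ D ℕ.* (∣ y ∣ ℕ.* ∣ y ∣))          ∎

N[a+4·f·half[r,q]] : ∀ D f r q a →
  N D (ι a ⊕ ((+ 4) · (f · half r q))) ≡ (a + + 2 * (f * r)) * (a + + 2 * (f * r)) + + D * ((+ 2 * (f * q)) * (+ 2 * (f * q)))
N[a+4·f·half[r,q]] D f r q a =
  trans (cong (N D) (cong₂ half (halve₁ a f r) (halve₂ f q))) (N-half-even D (a + + 2 * (f * r)) (+ 2 * (f * q)))
  where
  halve₁ : ∀ a f r → + 2 * a + + 4 * (f * r) ≡ + 2 * (a + + 2 * (f * r))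
  halve₁ = ℤ-Solver.solve-∀
  halve₂ : ∀ f q → + 0 + + 4 * (f * q) ≡ + 2 * (+ 2 * (f * q))
  halve₂ = ℤ-Solver.solve-∀

+[2*[k*D*[f*f]]] : ∀ k D f → + (2 ℕ.* (k ℕ.* D ℕ.* (f ℕ.* f))) ≡ + 2 * (+ k * + D * (+ f * + f))
+[2*[k*D*[f*f]]] k D f =
  trans (pos-* 2 (k ℕ.* D ℕ.* (f ℕ.* f)))
        (cong (+ 2 *_) (trans (pos-* (k ℕ.* D) (f ℕ.* f)) (cong₂ _*_ (pos-* k D) (pos-* f f))))

N[a+4θ] : ∀ f D → ∃ λ s → ∃ λ c → ∀ a →
  N D (ι a ⊕ ((+ 4) · θ f D)) ≡ (a + + 2 * s) * (a + + 2 * s) + + (2 ℕ.* c)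
N[a+4θ] f D with D ℕ.% 4 ℕ.≟ 3
... | yes _ = + f * + 1 , 2 ℕ.* D ℕ.* (f ℕ.* f) , λ a →
  trans (N[a+4·f·half[r,q]] D (+ f) (+ 1) (+ 1) a)
        (cong (_+_ ((a + + 2 * (+ f * + 1)) * (a + + 2 * (+ f * + 1)))) (trans (norm-term (+ D) (+ f)) (sym (+[2*[k*D*[f*f]]] 2 D f))))
  where
  norm-term : ∀ D f → D * ((+ 2 * (f * + 1)) * (+ 2 * (f * + 1))) ≡ + 2 * (+ 2 * D * (f * f))
  norm-term = ℤ-Solver.solve-∀
... | no _ = + f * + 0 , 8 ℕ.* D ℕ.* (f ℕ.* f) , λ a →
  trans (N[a+4·f·half[r,q]] D (+ f) (+ 0) (+ 2) a)
        (cong (_+_ ((a + + 2 * (+ f * + 0)) * (a + + 2 * (+ f * + 0)))) (trans (norm-term (+ D) (+ f)) (sym (+[2*[k*D*[f*f]]] 8 D f))))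
  where
  norm-term : ∀ D f → D * ((+ 2 * (f * + 2)) * (+ 2 * (f * + 2))) ≡ + 2 * (+ 8 * D * (f * f))
  norm-term = ℤ-Solver.solve-∀

lemma2p3 : (f D M : ℕ) → .{{NonZero f}} → .{{NonZero D}} → .{{NonZero M}} →
    SquareFree D →
    ∃ λ (l : ℕ) → (1 ≤ l) × (l ≤ M) ×
      (∀ (a : ℤ) → (+ (2 ℕ.* M)) ∣ (a - (+ (2 ℕ.* l) - + 1)) →
        gcd (N D (ι a ⊕ ((+ 4) · θ f D))) (+ (2 ℕ.* M)) ≡ + 1)
lemma2p3 f D M _ =
  let s , c , N≡ = N[a+4θ] f D
      l , 1≤l , l≤M , coprime = ∃-odd-class-coprime M s c
  in l , 1≤l , l≤M , λ a h → trans (cong (λ n → gcd n (+ (2 ℕ.* M))) (N≡ a)) (coprime a h)
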